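{- For all positive integers $m,n$, the complete bipartite graph $K_{m,n}$ belongs to $\mathfrak{T}$ and $W_\tau(K_{m,n})\geq m+n+1$.
   Context: All graphs are finite, undirected, without loops or multiple edges. A total coloring of a graph $G$ is an assignment of colors to the vertices and edges of $G$ such that no two adjacent vertices, no two adjacent edges, and no vertex and an edge incident to it receive the same color. For a positive integer $t$, an interval total $t$-coloring of $G$ is a total coloring of $G$ with colors $1,2,\ldots,t$ such that each color $i\in\{1,\ldots,t\}$ is used on at least one vertex or edge, and for each vertex $v$ the set consisting of the color of $v$ and the colors of the edges incident to $v$ consists of $d_G(v)+1$ consecutive integers, where $d_G(v)$ is the degree of $v$. $\mathfrak{T}$ is the set of graphs having an interval total $t$-coloring for some $t\geq1$, and for $G\in\mathfrak{T}$, $W_\tau(G)$ is the greatest such $t$. -}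

module Defs where

open import Data.Nat using (ℕ; zero; suc; _+_; _≤_; _<ᵇ_)
open import Data.Fin using (Fin; toℕ)
open import Data.Bool using (Bool; true; false; _xor_; if_then_else_)
open import Data.List using (List; map; allFin)
open import Data.Nat.ListAction using (sum)
open import Data.Product using (Σ; ∃; _×_; _,_)
open import Data.Sum using (_⊎_)
open import Relation.Binary.PropositionalEquality using (_≡_; _≢_)
open import Function.Bundles using (_⇔_)

record Graph : Set where
  field
    N     : ℕ
    adj   : Fin N → Fin N → Bool
    sym   : ∀ u v → adj u v ≡ adj v u
    irrefl : ∀ v → adj v v ≡ false
open Graph public

deg : (G : Graph) → Fin (N G) → ℕ
deg G v = sum (map (λ u → if adj G v u then 1 else 0) (allFin (N G)))

-- A total coloring candidate: colors of vertices and of (ordered) pairs;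
-- only the values on edges are meaningful, and they must be symmetric.
record TotalAssignment (G : Graph) : Set where
  field
    vcol : Fin (N G) → ℕ
    ecol : Fin (N G) → Fin (N G) → ℕ
open TotalAssignment public

InSpectrum : (G : Graph) → TotalAssignment G → Fin (N G) → ℕ → Set
InSpectrum G φ v k = (vcol φ v ≡ k) ⊎ (∃ λ u → (adj G v u ≡ true) × (ecol φ v u ≡ k))

record IsIntervalTotalColoring (G : Graph) (t : ℕ) (φ : TotalAssignment G) : Set where
  field
    edge-sym      : ∀ u v → adj G u v ≡ true → ecol φ u v ≡ ecol φ v u
    vcol-range    : ∀ v → (1 ≤ vcol φ v) × (vcol φ v ≤ t)
    ecol-range    : ∀ u v → adj G u v ≡ true → (1 ≤ ecol φ u v) × (ecol φ u v ≤ t)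
    adj-vertices  : ∀ u v → adj G u v ≡ true → vcol φ u ≢ vcol φ v
    adj-edges     : ∀ u v w → adj G u v ≡ true → adj G u w ≡ true → v ≢ w →
                    ecol φ u v ≢ ecol φ u w
    incident      : ∀ u v → adj G u v ≡ true → vcol φ u ≢ ecol φ u v
    surjective    : ∀ i → 1 ≤ i → i ≤ t →
                    (∃ λ v → vcol φ v ≡ i) ⊎
                    (∃ λ u → ∃ λ v → (adj G u v ≡ true) × (ecol φ u v ≡ i))
    interval      : ∀ v → ∃ λ a → ∀ k →
                    InSpectrum G φ v k ⇔ ((a ≤ k) × (k ≤ a + deg G v))

HasIntervalTotalColoring : Graph → ℕ → Set
HasIntervalTotalColoring G t = ∃ λ (φ : TotalAssignment G) → IsIntervalTotalColoring G t φ

InT : Graph → Set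
InT G = ∃ λ t → (1 ≤ t) × HasIntervalTotalColoring G t

Wτ≥ : Graph → ℕ → Set
Wτ≥ G s = ∃ λ t → (s ≤ t) × HasIntervalTotalColoring G t

side : ∀ {m n} → Fin (m + n) → Bool
side {m} i = toℕ i <ᵇ m

xor-comm : ∀ a b → a xor b ≡ b xor a
xor-comm true true = _≡_.refl
xor-comm true false = _≡_.refl
xor-comm false true = _≡_.refl
xor-comm false false = _≡_.refl

xor-self : ∀ a → a xor a ≡ false
xor-self true = _≡_.refl
xor-self false = _≡_.refl

K : ℕ → ℕ → Graph
K m n = record
  { N = m + n
  ; adj = λ i j → side {m} {n} i xor side {m} {n} j
  ; sym = λ i j → xor-comm (side {m} {n} i) (side {m} {n} j)
  ; irrefl = λ i → xor-self (side {m} {n} i)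
  }

-- Number the parts of K m n from 0 and colour the i-th vertex of the first part with i + 1,
-- the j-th vertex of the second part with m + j + 2, and the edge between them with i + j + 2.
-- A first-part vertex then sees its own colour i + 1 followed by the edge colours
-- i + 2, …, i + n + 1; a second-part vertex sees the edge colours j + 2, …, j + m + 1 followed
-- by its own colour j + m + 2.  Both spectra are intervals, adjacent or incident elements get
-- different colours, and all of 1, …, m + n + 1 occur, the colour m + 1 on the edge joining the
-- last vertex of the first part to the first vertex of the second.
module Submission where

open import Defs
open import Data.Nat using (ℕ; _+_; _≤_)
open import Data.Product using (_×_)

open import Data.Bool using (Bool; true; false; _xor_; if_then_else_)
open import Data.Fin using (Fin; zero; suc; toℕ; fromℕ; fromℕ<; _↑ˡ_; _↑ʳ_; splitAt)
open import Data.Fin.Properties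
  using (toℕ-↑ˡ; toℕ-↑ʳ; toℕ-injective; toℕ<n; toℕ-fromℕ; toℕ-fromℕ<;
         splitAt⁻¹-↑ˡ; splitAt⁻¹-↑ʳ)
open import Data.List using (tabulate)
open import Data.List.Properties using (map-tabulate; tabulate-cong)
open import Data.Nat using (zero; suc; _∸_; _*_; _<_; z≤n; s≤s; s≤s⁻¹)
open import Data.Nat.ListAction using (sum)
open import Data.Nat.Properties
open import Data.Product using (∃; _,_)
open import Data.Sum using (_⊎_; inj₁; inj₂)
open import Function using (_∘_; const)
open import Function.Bundles using (_⇔_; mk⇔)
open import Relation.Binary.Definitions using (tri<; tri≈; tri>)
open import Relation.Binary.PropositionalEquality
  using (_≡_; _≢_; refl; trans; cong; cong₂; subst; ≢-sym; module ≡-Reasoning)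
import Relation.Binary.PropositionalEquality as ≡

sum-tabulate-const : ∀ d c → sum (tabulate {n = d} (const c)) ≡ d * c
sum-tabulate-const zero    c = refl
sum-tabulate-const (suc d) c = cong (c +_) (sum-tabulate-const d c)

sum-tabulate-↑ : ∀ m {n} (f : Fin (m + n) → ℕ) →
                 sum (tabulate f) ≡ sum (tabulate (f ∘ (_↑ˡ n))) + sum (tabulate (f ∘ (m ↑ʳ_)))
sum-tabulate-↑ zero    f = refl
sum-tabulate-↑ (suc m) f = trans (cong (f zero +_) (sum-tabulate-↑ m (f ∘ suc))) (≡.sym (+-assoc (f zero) _ _))

a≤k<a+d⇒∃[j]a+j≡k : ∀ {a k d} → a ≤ k → k < a + d → ∃ λ (j : Fin d) → a + toℕ j ≡ k
a≤k<a+d⇒∃[j]a+j≡k {a} {k} {d} a≤k k<a+d =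
  fromℕ< k∸a<d , trans (cong (a +_) (toℕ-fromℕ< k∸a<d)) (m+[n∸m]≡n a≤k)
  where
  k∸a<d : k ∸ a < d
  k∸a<d = subst (k ∸ a <_) (m+n∸m≡n a d) (∸-monoˡ-< k<a+d a≤k)

a+j<a+d : ∀ a {d} (j : Fin d) → a + toℕ j < a + d
a+j<a+d a j = +-monoʳ-< a (toℕ<n j)

indicator : Bool → ℕ
indicator b = if b then 1 else 0

data Part (m n : ℕ) : Fin (m + n) → Set where
  left  : (i : Fin m) → Part m n (i ↑ˡ n)
  right : (j : Fin n) → Part m n (m ↑ʳ j)

part : ∀ m n (v : Fin (m + n)) → Part m n v
part m n v with splitAt m v in eq
... | inj₁ i = subst (Part m n) (splitAt⁻¹-↑ˡ eq) (left i)
... | inj₂ j = subst (Part m n) (splitAt⁻¹-↑ʳ eq) (right j)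

side-↑ˡ : ∀ {m n} (i : Fin m) → side {m} {n} (i ↑ˡ n) ≡ true
side-↑ˡ zero    = refl
side-↑ˡ (suc i) = side-↑ˡ i

side-↑ʳ : ∀ m {n} (j : Fin n) → side {m} {n} (m ↑ʳ j) ≡ false
side-↑ʳ zero    j = refl
side-↑ʳ (suc m) j = side-↑ʳ m j

module _ {m n : ℕ} where

  adj-↑ˡ↑ˡ : (i i′ : Fin m) → adj (K m n) (i ↑ˡ n) (i′ ↑ˡ n) ≡ false
  adj-↑ˡ↑ˡ i i′ = cong₂ _xor_ (side-↑ˡ i) (side-↑ˡ i′)

  adj-↑ˡ↑ʳ : (i : Fin m) (j : Fin n) → adj (K m n) (i ↑ˡ n) (m ↑ʳ j) ≡ true
  adj-↑ˡ↑ʳ i j = cong₂ _xor_ (side-↑ˡ i) (side-↑ʳ m j)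

  adj-↑ʳ↑ˡ : (j : Fin n) (i : Fin m) → adj (K m n) (m ↑ʳ j) (i ↑ˡ n) ≡ true
  adj-↑ʳ↑ˡ j i = cong₂ _xor_ (side-↑ʳ m j) (side-↑ˡ i)

  adj-↑ʳ↑ʳ : (j j′ : Fin n) → adj (K m n) (m ↑ʳ j) (m ↑ʳ j′) ≡ false
  adj-↑ʳ↑ʳ j j′ = cong₂ _xor_ (side-↑ʳ m j) (side-↑ʳ m j′)

  neighbour-↑ˡ : (i : Fin m) (v : Fin (m + n)) → adj (K m n) (i ↑ˡ n) v ≡ true → ∃ λ j → v ≡ m ↑ʳ j
  neighbour-↑ˡ i v uv with part m n v
  ... | left i′ with () ← trans (≡.sym (adj-↑ˡ↑ˡ i i′)) uv
  ... | right j = j , refl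

  neighbour-↑ʳ : (j : Fin n) (v : Fin (m + n)) → adj (K m n) (m ↑ʳ j) v ≡ true → ∃ λ i → v ≡ i ↑ˡ n
  neighbour-↑ʳ j v uv with part m n v
  ... | left i = i , refl
  ... | right j′ with () ← trans (≡.sym (adj-↑ʳ↑ʳ j j′)) uv

  neighbourhood-sizes : (v : Fin (m + n)) →
    deg (K m n) v ≡ sum (tabulate (indicator ∘ adj (K m n) v ∘ (_↑ˡ n)))
                  + sum (tabulate (indicator ∘ adj (K m n) v ∘ (m ↑ʳ_)))
  neighbourhood-sizes v =
    trans (cong sum (map-tabulate (λ u → u) (indicator ∘ adj (K m n) v))) (sum-tabulate-↑ m _)

  deg-↑ˡ : (i : Fin m) → deg (K m n) (i ↑ˡ n) ≡ n
  deg-↑ˡ i = begin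
    deg (K m n) (i ↑ˡ n)
      ≡⟨ neighbourhood-sizes (i ↑ˡ n) ⟩
    _ ≡⟨ cong₂ _+_ (cong sum (tabulate-cong (cong indicator ∘ adj-↑ˡ↑ˡ i)))
                   (cong sum (tabulate-cong (cong indicator ∘ adj-↑ˡ↑ʳ i))) ⟩
    sum (tabulate {n = m} (const 0)) + sum (tabulate {n = n} (const 1))
      ≡⟨ cong₂ _+_ (sum-tabulate-const m 0) (sum-tabulate-const n 1) ⟩
    m * 0 + n * 1
      ≡⟨ cong₂ _+_ (*-zeroʳ m) (*-identityʳ n) ⟩
    n ∎
    where open ≡-Reasoning

  deg-↑ʳ : (j : Fin n) → deg (K m n) (m ↑ʳ j) ≡ m
  deg-↑ʳ j = begin
    deg (K m n) (m ↑ʳ j)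
      ≡⟨ neighbourhood-sizes (m ↑ʳ j) ⟩
    _ ≡⟨ cong₂ _+_ (cong sum (tabulate-cong (cong indicator ∘ adj-↑ʳ↑ˡ j)))
                   (cong sum (tabulate-cong (cong indicator ∘ adj-↑ʳ↑ʳ j))) ⟩
    sum (tabulate {n = m} (const 1)) + sum (tabulate {n = n} (const 0))
      ≡⟨ cong₂ _+_ (sum-tabulate-const m 1) (sum-tabulate-const n 0) ⟩
    m * 1 + n * 0
      ≡⟨ cong₂ _+_ (*-identityʳ m) (*-zeroʳ n) ⟩
    m + 0
      ≡⟨ +-identityʳ m ⟩
    m ∎
    where open ≡-Reasoning

  spectrum-↑ˡ : (φ : TotalAssignment (K m n)) (i : Fin m) {a : ℕ} →
                vcol φ (i ↑ˡ n) ≡ a → (∀ j → ecol φ (i ↑ˡ n) (m ↑ʳ j) ≡ suc a + toℕ j) →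
                ∀ k → InSpectrum (K m n) φ (i ↑ˡ n) k ⇔ (a ≤ k × k ≤ a + n)
  spectrum-↑ˡ φ i {a} vertex edge k = mk⇔ to from
    where
    to : ∀ {k} → InSpectrum (K m n) φ (i ↑ˡ n) k → a ≤ k × k ≤ a + n
    to (inj₁ refl) rewrite vertex = ≤-refl , m≤m+n a n
    to (inj₂ (v , iv , refl)) with neighbour-↑ˡ i v iv
    ... | j , refl rewrite edge j = ≤-trans (n≤1+n a) (m≤m+n (suc a) (toℕ j)) , s≤s⁻¹ (a+j<a+d (suc a) j)
    from : ∀ {k} → a ≤ k × k ≤ a + n → InSpectrum (K m n) φ (i ↑ˡ n) k
    from (a≤k , k≤a+n) with m≤n⇒m<n∨m≡n a≤k
    ... | inj₂ refl = inj₁ vertex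
    ... | inj₁ a<k with a≤k<a+d⇒∃[j]a+j≡k a<k (s≤s k≤a+n)
    ...   | j , refl = inj₂ (m ↑ʳ j , adj-↑ˡ↑ʳ i j , edge j)

  spectrum-↑ʳ : (φ : TotalAssignment (K m n)) (j : Fin n) {a : ℕ} →
                vcol φ (m ↑ʳ j) ≡ a + m → (∀ i → ecol φ (m ↑ʳ j) (i ↑ˡ n) ≡ a + toℕ i) →
                ∀ k → InSpectrum (K m n) φ (m ↑ʳ j) k ⇔ (a ≤ k × k ≤ a + m)
  spectrum-↑ʳ φ j {a} vertex edge k = mk⇔ to from
    where
    to : ∀ {k} → InSpectrum (K m n) φ (m ↑ʳ j) k → a ≤ k × k ≤ a + m
    to (inj₁ refl) rewrite vertex = m≤m+n a m , ≤-refl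
    to (inj₂ (v , jv , refl)) with neighbour-↑ʳ j v jv
    ... | i , refl rewrite edge i = m≤m+n a (toℕ i) , <⇒≤ (a+j<a+d a i)
    from : ∀ {k} → a ≤ k × k ≤ a + m → InSpectrum (K m n) φ (m ↑ʳ j) k
    from (a≤k , k≤a+m) with m≤n⇒m<n∨m≡n k≤a+m
    ... | inj₂ refl = inj₁ vertex
    ... | inj₁ k<a+m with a≤k<a+d⇒∃[j]a+j≡k a≤k k<a+m
    ...   | i , refl = inj₂ (i ↑ˡ n , adj-↑ʳ↑ˡ j i , edge i)

colouring : ∀ m n → TotalAssignment (K m n)
colouring m n = record
  { vcol = λ v → if side {m} {n} v then suc (toℕ v) else 2 + toℕ v
  -- on the edge {i ↑ˡ n , m ↑ʳ j} the index sum is m + i + j, so the edge gets i + j + 2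
  ; ecol = λ u v → 2 + (toℕ u + toℕ v ∸ m)
  }

module Colouring (m n : ℕ) where

  private
    φ : TotalAssignment (K m n)
    φ = colouring m n

  vcol-↑ˡ : (i : Fin m) → vcol φ (i ↑ˡ n) ≡ 1 + toℕ i
  vcol-↑ˡ i rewrite side-↑ˡ {n = n} i | toℕ-↑ˡ i n = refl

  vcol-↑ʳ : (j : Fin n) → vcol φ (m ↑ʳ j) ≡ 2 + m + toℕ j
  vcol-↑ʳ j rewrite side-↑ʳ m j | toℕ-↑ʳ m j = refl

  ecol-comm : ∀ u v → ecol φ u v ≡ ecol φ v u
  ecol-comm u v = cong (λ s → 2 + (s ∸ m)) (+-comm (toℕ u) (toℕ v))

  ecol-↑ʳ↑ˡ : (j : Fin n) (i : Fin m) → ecol φ (m ↑ʳ j) (i ↑ˡ n) ≡ 2 + toℕ j + toℕ i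
  ecol-↑ʳ↑ˡ j i rewrite toℕ-↑ʳ m j | toℕ-↑ˡ i n =
    cong (2 +_) (trans (cong (_∸ m) (+-assoc m (toℕ j) (toℕ i))) (m+n∸m≡n m _))

  ecol-↑ˡ↑ʳ : (i : Fin m) (j : Fin n) → ecol φ (i ↑ˡ n) (m ↑ʳ j) ≡ 2 + toℕ i + toℕ j
  ecol-↑ˡ↑ʳ i j = begin
    ecol φ (i ↑ˡ n) (m ↑ʳ j)  ≡⟨ ecol-comm (i ↑ˡ n) (m ↑ʳ j) ⟩
    ecol φ (m ↑ʳ j) (i ↑ˡ n)  ≡⟨ ecol-↑ʳ↑ˡ j i ⟩
    2 + (toℕ j + toℕ i)                     ≡⟨ cong (2 +_) (+-comm (toℕ j) (toℕ i)) ⟩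
    2 + (toℕ i + toℕ j)                     ∎
    where open ≡-Reasoning

  ≤1+m+n⇒≤m+n+1 : ∀ {k} → k ≤ 1 + (m + n) → k ≤ m + n + 1
  ≤1+m+n⇒≤m+n+1 {k} = subst (k ≤_) (+-comm 1 (m + n))

  vcol-range : ∀ v → 1 ≤ vcol φ v × vcol φ v ≤ m + n + 1
  vcol-range v with part m n v
  ... | left i  rewrite vcol-↑ˡ i = s≤s z≤n , ≤1+m+n⇒≤m+n+1 (≤-trans (toℕ<n i) (≤-trans (m≤m+n m n) (n≤1+n _)))
  ... | right j rewrite vcol-↑ʳ j = s≤s z≤n , ≤1+m+n⇒≤m+n+1 (s≤s (a+j<a+d m j))

  ecol-↑ˡ↑ʳ-range : (i : Fin m) (j : Fin n) →
                    1 ≤ ecol φ (i ↑ˡ n) (m ↑ʳ j) × ecol φ (i ↑ˡ n) (m ↑ʳ j) ≤ m + n + 1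
  ecol-↑ˡ↑ʳ-range i j rewrite ecol-↑ˡ↑ʳ i j =
    s≤s z≤n , ≤-trans (subst (_≤ m + n) 1+i+1+j≡2+i+j (+-mono-≤ (toℕ<n i) (toℕ<n j))) (m≤m+n (m + n) 1)
    where
    1+i+1+j≡2+i+j : 1 + toℕ i + (1 + toℕ j) ≡ 2 + toℕ i + toℕ j
    1+i+1+j≡2+i+j = cong suc (+-suc (toℕ i) (toℕ j))

  ecol-range : ∀ u v → adj (K m n) u v ≡ true →
               1 ≤ ecol φ u v × ecol φ u v ≤ m + n + 1
  ecol-range u v uv with part m n u
  ... | left i with neighbour-↑ˡ i v uv
  ...   | j , refl = ecol-↑ˡ↑ʳ-range i j
  ecol-range u v uv | right j with neighbour-↑ʳ j v uv
  ...   | i , refl rewrite ecol-comm (m ↑ʳ j) (i ↑ˡ n) = ecol-↑ˡ↑ʳ-range i j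

  vcol-↑ˡ≢vcol-↑ʳ : (i : Fin m) (j : Fin n) → vcol φ (i ↑ˡ n) ≢ vcol φ (m ↑ʳ j)
  vcol-↑ˡ≢vcol-↑ʳ i j rewrite vcol-↑ˡ i | vcol-↑ʳ j =
    <⇒≢ (s≤s (≤-trans (toℕ<n i) (≤-trans (m≤m+n m (toℕ j)) (n≤1+n _))))

  adjacent-vcol-≢ : ∀ u v → adj (K m n) u v ≡ true → vcol φ u ≢ vcol φ v
  adjacent-vcol-≢ u v uv with part m n u
  ... | left i with neighbour-↑ˡ i v uv
  ...   | j , refl = vcol-↑ˡ≢vcol-↑ʳ i j
  adjacent-vcol-≢ u v uv | right j with neighbour-↑ʳ j v uv
  ...   | i , refl = ≢-sym (vcol-↑ˡ≢vcol-↑ʳ i j)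

  ecol-↑ˡ-injective : (i : Fin m) (j j′ : Fin n) →
                      ecol φ (i ↑ˡ n) (m ↑ʳ j) ≡ ecol φ (i ↑ˡ n) (m ↑ʳ j′) → m ↑ʳ j ≡ m ↑ʳ j′
  ecol-↑ˡ-injective i j j′ eq = cong (m ↑ʳ_) (toℕ-injective (+-cancelˡ-≡ (2 + toℕ i) _ _
    (trans (≡.sym (ecol-↑ˡ↑ʳ i j)) (trans eq (ecol-↑ˡ↑ʳ i j′)))))

  ecol-↑ʳ-injective : (j : Fin n) (i i′ : Fin m) →
                      ecol φ (m ↑ʳ j) (i ↑ˡ n) ≡ ecol φ (m ↑ʳ j) (i′ ↑ˡ n) → i ↑ˡ n ≡ i′ ↑ˡ n
  ecol-↑ʳ-injective j i i′ eq = cong (_↑ˡ n) (toℕ-injective (+-cancelˡ-≡ (2 + toℕ j) _ _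
    (trans (≡.sym (ecol-↑ʳ↑ˡ j i)) (trans eq (ecol-↑ʳ↑ˡ j i′)))))

  incident-ecol-≢ : ∀ u v w → adj (K m n) u v ≡ true → adj (K m n) u w ≡ true → v ≢ w →
                    ecol φ u v ≢ ecol φ u w
  incident-ecol-≢ u v w uv uw v≢w with part m n u
  ... | left i with neighbour-↑ˡ i v uv | neighbour-↑ˡ i w uw
  ...   | j , refl | j′ , refl = v≢w ∘ ecol-↑ˡ-injective i j j′
  incident-ecol-≢ u v w uv uw v≢w | right j with neighbour-↑ʳ j v uv | neighbour-↑ʳ j w uw
  ...   | i , refl | i′ , refl = v≢w ∘ ecol-↑ʳ-injective j i i′

  vcol-≢-incident-ecol : ∀ u v → adj (K m n) u v ≡ true → vcol φ u ≢ ecol φ u v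
  vcol-≢-incident-ecol u v uv with part m n u
  ... | left i with neighbour-↑ˡ i v uv
  ...   | j , refl rewrite vcol-↑ˡ i | ecol-↑ˡ↑ʳ i j = <⇒≢ (s≤s (s≤s (m≤m+n (toℕ i) (toℕ j))))
  vcol-≢-incident-ecol u v uv | right j with neighbour-↑ʳ j v uv
  ...   | i , refl rewrite vcol-↑ʳ j | ecol-↑ʳ↑ˡ j i =
    >⇒≢ (s≤s (s≤s (subst (toℕ j + toℕ i <_) (+-comm (toℕ j) m) (a+j<a+d (toℕ j) i))))

  Interval : Fin (m + n) → ℕ → ℕ → Set
  Interval v a d = ∀ k → InSpectrum (K m n) φ v k ⇔ (a ≤ k × k ≤ a + d)

  interval : ∀ v → ∃ λ a → Interval v a (deg (K m n) v)
  interval v with part m n v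
  ... | left i  = 1 + toℕ i , subst (Interval (i ↑ˡ n) (1 + toℕ i)) (≡.sym (deg-↑ˡ i))
                    (spectrum-↑ˡ φ i (vcol-↑ˡ i) (ecol-↑ˡ↑ʳ i))
  ... | right j = 2 + toℕ j , subst (Interval (m ↑ʳ j) (2 + toℕ j)) (≡.sym (deg-↑ʳ j))
                    (spectrum-↑ʳ φ j (trans (vcol-↑ʳ j) (cong (2 +_) (+-comm m (toℕ j)))) (ecol-↑ʳ↑ˡ j))

last-edge-colour : ∀ {m n} → 1 ≤ m → 1 ≤ n →
                   ∃ λ (i : Fin m) → ∃ λ (j : Fin n) → ecol (colouring m n) (i ↑ˡ n) (m ↑ʳ j) ≡ 1 + m
last-edge-colour {suc m} {suc n} _ _ =
  fromℕ m , zero , trans (ecol-↑ˡ↑ʳ (fromℕ m) zero) (cong (2 +_) (trans (+-identityʳ _) (toℕ-fromℕ m)))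
  where open Colouring (suc m) (suc n)

module _ {m n : ℕ} where
  open Colouring m n

  colouring-surjective : 1 ≤ m → 1 ≤ n → ∀ k → 1 ≤ k → k ≤ m + n + 1 →
                         (∃ λ v → vcol (colouring m n) v ≡ k) ⊎
                         (∃ λ u → ∃ λ v → adj (K m n) u v ≡ true × ecol (colouring m n) u v ≡ k)
  colouring-surjective 1≤m 1≤n k 1≤k k≤m+n+1 with <-cmp k (1 + m)
  ... | tri< k<1+m _ _ with a≤k<a+d⇒∃[j]a+j≡k 1≤k k<1+m
  ...   | i , refl = inj₁ (i ↑ˡ n , vcol-↑ˡ i)
  colouring-surjective 1≤m 1≤n k _ _ | tri≈ _ refl _ with last-edge-colour 1≤m 1≤n
  ...   | i , j , ij≡1+m = inj₂ (i ↑ˡ n , m ↑ʳ j , adj-↑ˡ↑ʳ i j , ij≡1+m)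
  colouring-surjective _ _ k _ k≤m+n+1 | tri> _ _ 1+m<k
    with a≤k<a+d⇒∃[j]a+j≡k 1+m<k (subst (k <_) (cong suc (+-comm (m + n) 1)) (s≤s k≤m+n+1))
  ...   | j , refl = inj₁ (m ↑ʳ j , vcol-↑ʳ j)

  isIntervalTotalColouring : 1 ≤ m → 1 ≤ n → IsIntervalTotalColoring (K m n) (m + n + 1) (colouring m n)
  isIntervalTotalColouring 1≤m 1≤n = record
    { edge-sym     = λ u v _ → ecol-comm u v
    ; vcol-range   = vcol-range
    ; ecol-range   = ecol-range
    ; adj-vertices = adjacent-vcol-≢
    ; adj-edges    = incident-ecol-≢
    ; incident     = vcol-≢-incident-ecol
    ; surjective   = colouring-surjective 1≤m 1≤n
    ; interval     = interval
    }

corollary6 : ∀ (m n : ℕ) → 1 ≤ m → 1 ≤ n → InT (K m n) × Wτ≥ (K m n) (m + n + 1)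
corollary6 m n 1≤m 1≤n = (m + n + 1 , m≤n+m 1 (m + n) , coloured) , (m + n + 1 , ≤-refl , coloured)
  where
  coloured : HasIntervalTotalColoring (K m n) (m + n + 1)
  coloured = colouring m n , isIntervalTotalColouring 1≤m 1≤n
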